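{- Let $T$ be the complete $q$-ary tree of depth $d$ ($q\ge 2$), and let $S\subseteq V(T)$ be both left-compressed and down-compressed. Then for every vertex $u\in S$, one of the following holds: (1) all children of $u$ are in $S$; (2) exactly one child $v$ of $u$ is not in $S$, and $v$ has at least one child not in $S$; or (3) exactly two children $v_1,v_2$ of $u$ are not in $S$, where $v_1$ has at least one child in $S$ and at least one child not in $S$, and $v_2$ has no children in $S$.
   Context: The complete $q$-ary tree of depth $d$ is the rooted tree in which every vertex at distance less than $d$ from the root has exactly $q$ children, and vertices at distance $d$ are leaves. $L_i$ is the set of vertices at distance $i$ from the root; $\mathrm{children}(w)$ denotes the children of $w$. The vertices are linearly ordered breadth-first: the root first; vertices of $L_i$ before those of $L_j$ for $i<j$; within a level, if $x$ precedes $y$ then all children of $x$ precede all children of $y$; children $w^{(1)},\dots,w^{(q)}$ of $w$ appear in this order. A vertex $x$ is to the left of $y$ if they are in the same level and $x$ precedes $y$. For $S\subseteq V(T)$, $\delta(S)=\{x\notin S: N(x)\cap S\neq\emptyset\}$. Two vertices $u,v$ are swappable in $S$ if $u$ is to the left of $v$ and either $u\notin S,\ v\in S$, or $u,v\notin S$, $\mathrm{children}(u)\cap S=\emptyset$, $\mathrm{children}(v)\cap S\ne\emptyset$. $S$ is left-compressed if no pair of vertices is swappable in $S$. Two vertices $u\in S$, $v\notin S$ are down-swappable in $S$ if either $|\delta((S\cup\{v\})\setminus\{u\})|<|\delta(S)|$, or $|\delta((S\cup\{v\})\setminus\{u\})|=|\delta(S)|$ and $v$ is further from the root than $u$. $S$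 is down-compressed if no pair is down-swappable in $S$. -}

module Defs where

open import Data.Nat using (ℕ; zero; suc; _≤_; _<_)
open import Data.Fin using (Fin) renaming (_<_ to _<ᶠ_)
open import Data.Fin.Properties using () renaming (_≟_ to _≟ᶠ_)
open import Data.List using (List; []; _∷_; _++_; [_]; length; map; concatMap; filter; upTo; allFin)
open import Data.Bool.ListAction using (any)
open import Data.List.Properties using (≡-dec)
open import Data.Bool using (Bool; true; false; _∧_; _∨_; not)
open import Data.Product using (Σ; _×_; ∃; ∃-syntax)
open import Data.Sum using (_⊎_)
open import Relation.Nullary using (¬_)
open import Relation.Nullary.Decidable using (⌊_⌋; does)
open import Relation.Binary.PropositionalEquality using (_≡_)

-- A vertex of the complete q-ary tree of depth d is the path from the root:
-- a list of child indices (root = []), child i of w is  w ++ [ i ]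
-- (i = 0 .. q-1 corresponding to w^(1) .. w^(q)).  Vertices are the lists of
-- length ≤ d; the level of a vertex (distance from root) is its length.
Path : ℕ → Set
Path q = List (Fin q)

child : ∀ {q} → Path q → Fin q → Path q
child w i = w ++ [ i ]

_≟ₚ_ : ∀ {q} (x y : Path q) → Relation.Nullary.Dec (x ≡ y)
_≟ₚ_ = ≡-dec _≟ᶠ_

levelVs : (q k : ℕ) → List (Path q)
levelVs q zero = [] ∷ []
levelVs q (suc k) = concatMap (λ w → map (child w) (allFin q)) (levelVs q k)

vertices : (q d : ℕ) → List (Path q)
vertices q d = concatMap (levelVs q) (upTo (suc d))

adj : ∀ {q} → Path q → Path q → Bool
adj {q} x y = any (λ i → ⌊ y ≟ₚ child x i ⌋) (allFin q)
            ∨ any (λ i → ⌊ x ≟ₚ child y i ⌋) (allFin q)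

-- a vertex set S ⊆ V(T) is given by its (decidable) characteristic function;
-- only its values on vertices of the tree matter.
VSet : ℕ → Set
VSet q = Path q → Bool

count : ∀ {A : Set} → (A → Bool) → List A → ℕ
count p [] = zero
count p (x ∷ xs) with p x
... | true = suc (count p xs)
... | false = count p xs

boundarySize : (q d : ℕ) → VSet q → ℕ
boundarySize q d S =
  count (λ x → not (S x) ∧ any (λ y → adj x y ∧ S y) (vertices q d)) (vertices q d)

swapSet : ∀ {q} → VSet q → Path q → Path q → VSet q
swapSet S u v w = ⌊ w ≟ₚ v ⌋ ∨ (S w ∧ not ⌊ w ≟ₚ u ⌋)

InTree : ∀ {q} → ℕ → Path q → Set
InTree d x = length x ≤ d

-- lexicographic strict order on paths (for paths of the same length this is
-- exactly the breadth-first order within a level)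
data Lex {q : ℕ} : Path q → Path q → Set where
  here  : ∀ {a b x y} → a <ᶠ b → Lex (a ∷ x) (b ∷ y)
  there : ∀ {a x y} → Lex x y → Lex (a ∷ x) (a ∷ y)

LeftOf : ∀ {q} → Path q → Path q → Set
LeftOf x y = length x ≡ length y × Lex x y

HasChildIn : ∀ {q} → ℕ → VSet q → Path q → Set
HasChildIn d S w = length w < d × ∃[ i ] S (child w i) ≡ true

HasChildOut : ∀ {q} → ℕ → VSet q → Path q → Set
HasChildOut d S w = length w < d × ∃[ i ] S (child w i) ≡ false

Swappable : ∀ {q} → ℕ → VSet q → Path q → Path q → Set
Swappable d S u v =
  LeftOf u v ×
  ((S u ≡ false × S v ≡ true)
   ⊎ (S u ≡ false × S v ≡ false × ¬ HasChildIn d S u × HasChildIn d S v))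

LeftCompressed : (q d : ℕ) → VSet q → Set
LeftCompressed q d S =
  ∀ (u v : Path q) → InTree d u → InTree d v → ¬ Swappable d S u v

DownSwappable : (q d : ℕ) → VSet q → Path q → Path q → Set
DownSwappable q d S u v =
  S u ≡ true × S v ≡ false ×
  (boundarySize q d (swapSet S u v) < boundarySize q d S
   ⊎ (boundarySize q d (swapSet S u v) ≡ boundarySize q d S × length u < length v))

DownCompressed : (q d : ℕ) → VSet q → Set
DownCompressed q d S =
  ∀ (u v : Path q) → InTree d u → InTree d v → ¬ DownSwappable q d S u v

module Submission where

-- Fix u ∈ S.  A child v ∉ S all of whose children lie in S could be swapped
-- with u: v leaves the boundary δ(S) and at most u enters it, so |δ(S)| does
-- not grow although v is deeper than u, against down-compression.  Two
-- children v₁, v₂ ∉ S that both have no child in S are impossible as well: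
-- descend from v₁ through vertices outside S to some x whose children all lie
-- in S and swap u with x; then v₁ and v₂ leave the boundary while at most u
-- and the parent of x enter it.  Two children that both have children inside
-- and outside S contradict left-compression, since an outside grandchild would
-- lie to the left of an inside one.  So of any two children outside S exactly
-- one has a child in S, which also rules out three of them.

open import Defs
open import Data.Bool using (Bool; true; false; _∧_; not) renaming (_≟_ to _≟ᵇ_)
open import Data.Bool.ListAction using (any)
open import Data.Bool.Properties using (¬-not; ∧-identityʳ; ∧-zeroʳ; ∨-zeroʳ)
open import Data.Empty using (⊥; ⊥-elim)
open import Data.Fin using (Fin) renaming (_<_ to _<ᶠ_)
open import Data.Fin.Properties using (any?) renaming (_≟_ to _≟ᶠ_; <-cmp to <ᶠ-cmp)
open import Data.List using (List; []; _∷_; _++_; [_]; length; map; concatMap; upTo; allFin)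
open import Data.List.Membership.Propositional using (_∈_; _∉_)
open import Data.List.Membership.Propositional.Properties using (∈-allFin; ∈-upTo⁺; ∈-upTo⁻; ∈-map⁺; ∈-map⁻)
open import Data.List.Properties using (map-++; ++-assoc; ++-identityʳ; ++-cancelˡ; ∷-injectiveˡ; ∷ʳ-injectiveˡ; ∷ʳ-injectiveʳ; length-++; length-++-≤ˡ)
open import Data.List.Relation.Unary.All using ([]; _∷_)
open import Data.List.Relation.Unary.All.Properties using (All¬⇒¬Any)
open import Data.List.Relation.Unary.Any using (here; there)
open import Data.List.Relation.Unary.Unique.Propositional using (Unique; []; _∷_)
open import Data.List.Relation.Unary.Unique.Propositional.Properties using (allFin⁺; upTo⁺; map⁺)
open import Data.Nat using (ℕ; zero; suc; _+_; _≤_; _<_; z≤n; s≤s; _<?_) renaming (_≟_ to _≟ℕ_)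
open import Data.Nat.ListAction using (sum)
open import Data.Nat.ListAction.Properties using (sum-++)
open import Data.Nat.Properties
open import Algebra.Properties.CommutativeSemigroup +-commutativeSemigroup using (interchange)
open import Data.Product using (_×_; _,_; ∃-syntax; proj₁; proj₂)
open import Data.Sum using (_⊎_; inj₁; inj₂; map₂)
open import Relation.Binary using (DecidableEquality; tri<; tri≈; tri>)
open import Relation.Binary.PropositionalEquality hiding ([_])
open import Relation.Nullary using (¬_; Dec; yes; no; contradiction)
open import Relation.Nullary.Decidable using (⌊_⌋; _×-dec_; ¬?)
open import Relation.Unary using (Decidable)

private
  variable
    A B : Set

isYes⁺ : (a? : Dec A) → A → ⌊ a? ⌋ ≡ true
isYes⁺ (yes _) _ = refl
isYes⁺ (no ¬a) a = contradiction a ¬a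

isYes⁻ : (a? : Dec A) → ⌊ a? ⌋ ≡ true → A
isYes⁻ (yes a) _  = a
isYes⁻ (no _)  ()

any≡true⁺ : ∀ (p : A → Bool) {xs y} → y ∈ xs → p y ≡ true → any p xs ≡ true
any≡true⁺ p {x ∷ xs} (here refl) py rewrite py = refl
any≡true⁺ p {x ∷ xs} (there y∈xs) py with p x
... | true  = refl
... | false = any≡true⁺ p y∈xs py

any≡true⁻ : ∀ (p : A → Bool) xs → any p xs ≡ true → ∃[ y ] y ∈ xs × p y ≡ true
any≡true⁻ p (x ∷ xs) any≡true with p x in px
... | true  = x , here refl , px
... | false with any≡true⁻ p xs any≡true
...   | y , y∈xs , py = y , there y∈xs , py

∧≡true⁻ : ∀ {a b} → a ∧ b ≡ true → a ≡ true × b ≡ true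
∧≡true⁻ {true} {true} _ = refl , refl

Opposite : Set → Set → Set
Opposite A B = (A × ¬ B) ⊎ (¬ A × B)

opposite-triangle : ∀ {A B C : Set} → Opposite A B → Opposite A C → Opposite B C → ⊥
opposite-triangle (inj₁ (_ , ¬b)) (inj₁ _)        (inj₁ (b , _))  = ¬b b
opposite-triangle (inj₁ _)        (inj₁ (_ , ¬c)) (inj₂ (_ , c))  = ¬c c
opposite-triangle (inj₁ (a , _))  (inj₂ (¬a , _)) _               = ¬a a
opposite-triangle (inj₂ (¬a , _)) (inj₁ (a , _))  _               = ¬a a
opposite-triangle (inj₂ _)        (inj₂ (_ , c))  (inj₁ (_ , ¬c)) = ¬c c
opposite-triangle (inj₂ (_ , b))  (inj₂ _)        (inj₂ (¬b , _)) = ¬b b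

none⊎one⊎two⊎three : ∀ {n} {P : Fin n → Set} → Decidable P →
  (∀ i → ¬ P i)
  ⊎ (∃[ j ] P j × (∀ i → i ≢ j → ¬ P i))
  ⊎ (∃[ j ] ∃[ k ] j ≢ k × P j × P k × (∀ i → i ≢ j → i ≢ k → ¬ P i))
  ⊎ (∃[ j ] ∃[ k ] ∃[ l ] j ≢ k × j ≢ l × k ≢ l × P j × P k × P l)
none⊎one⊎two⊎three P? with any? P?
... | no ∄j = inj₁ (λ i Pi → ∄j (i , Pi))
... | yes (j , Pj) with any? (λ i → ¬? (i ≟ᶠ j) ×-dec P? i)
...   | no ∄k = inj₂ (inj₁ (j , Pj , λ i i≢j Pi → ∄k (i , i≢j , Pi)))
...   | yes (k , k≢j , Pk) with any? (λ i → ¬? (i ≟ᶠ j) ×-dec ¬? (i ≟ᶠ k) ×-dec P? i)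
...     | no ∄l = inj₂ (inj₂ (inj₁ (j , k , ≢-sym k≢j , Pj , Pk ,
                    λ i i≢j i≢k Pi → ∄l (i , i≢j , i≢k , Pi))))
...     | yes (l , l≢j , l≢k , Pl) =
                    inj₂ (inj₂ (inj₂ (j , k , l , ≢-sym k≢j , ≢-sym l≢j , ≢-sym l≢k , Pj , Pk , Pl)))

-- Sums over lists and multiplicities

𝟙 : Bool → ℕ
𝟙 true  = 1
𝟙 false = 0

∑ : (A → ℕ) → List A → ℕ
∑ f xs = sum (map f xs)

count≡∑ : ∀ (p : A → Bool) xs → count p xs ≡ ∑ (λ x → 𝟙 (p x)) xs
count≡∑ p [] = refl
count≡∑ p (x ∷ xs) with p x
... | true  = cong suc (count≡∑ p xs)
... | false = count≡∑ p xs

∑-++ : ∀ (f : A → ℕ) xs ys → ∑ f (xs ++ ys) ≡ ∑ f xs + ∑ f ys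
∑-++ f xs ys = trans (cong sum (map-++ f xs ys)) (sum-++ (map f xs) (map f ys))

∑-concatMap : ∀ (f : B → ℕ) (g : A → List B) xs →
              ∑ f (concatMap g xs) ≡ ∑ (λ x → ∑ f (g x)) xs
∑-concatMap f g []       = refl
∑-concatMap f g (x ∷ xs) =
  trans (∑-++ f (g x) (concatMap g xs)) (cong (∑ f (g x) +_) (∑-concatMap f g xs))

∑-cong : ∀ {f g : A → ℕ} → (∀ x → f x ≡ g x) → ∀ xs → ∑ f xs ≡ ∑ g xs
∑-cong f≗g []       = refl
∑-cong f≗g (x ∷ xs) = cong₂ _+_ (f≗g x) (∑-cong f≗g xs)

∑-zero : ∀ {f : A → ℕ} → (∀ x → f x ≡ 0) → ∀ xs → ∑ f xs ≡ 0
∑-zero f≗0 xs = trans (∑-cong f≗0 xs) (∑-const-0 xs)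
  where
  ∑-const-0 : ∀ xs → ∑ (λ _ → 0) xs ≡ 0
  ∑-const-0 []       = refl
  ∑-const-0 (_ ∷ xs) = ∑-const-0 xs

∑-mono : ∀ {f g : A → ℕ} xs → (∀ x → x ∈ xs → f x ≤ g x) → ∑ f xs ≤ ∑ g xs
∑-mono []       f≤g = z≤n
∑-mono (x ∷ xs) f≤g = +-mono-≤ (f≤g x (here refl)) (∑-mono xs (λ y y∈xs → f≤g y (there y∈xs)))

∑-+ : ∀ (f g : A → ℕ) xs → ∑ (λ x → f x + g x) xs ≡ ∑ f xs + ∑ g xs
∑-+ f g []       = refl
∑-+ f g (x ∷ xs) =
  trans (cong (f x + g x +_) (∑-+ f g xs)) (interchange (f x) (g x) (∑ f xs) (∑ g xs))

∑-≤-length : ∀ {f : A → ℕ} xs → (∀ x → x ∈ xs → f x ≤ 1) → ∑ f xs ≤ length xs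
∑-≤-length []       f≤1 = z≤n
∑-≤-length (x ∷ xs) f≤1 = +-mono-≤ (f≤1 x (here refl)) (∑-≤-length xs (λ y y∈xs → f≤1 y (there y∈xs)))

∑-≡-length : ∀ {f : A → ℕ} xs → (∀ x → x ∈ xs → f x ≡ 1) → ∑ f xs ≡ length xs
∑-≡-length []       f≡1 = refl
∑-≡-length (x ∷ xs) f≡1 = cong₂ _+_ (f≡1 x (here refl)) (∑-≡-length xs (λ y y∈xs → f≡1 y (there y∈xs)))

∑-comm : ∀ (f : A → B → ℕ) xs ys →
         ∑ (λ x → ∑ (f x) ys) xs ≡ ∑ (λ y → ∑ (λ x → f x y) xs) ys
∑-comm f []       ys = sym (∑-zero (λ _ → refl) ys)
∑-comm f (x ∷ xs) ys =
  trans (cong (∑ (f x) ys +_) (∑-comm f xs ys)) (sym (∑-+ (f x) _ ys))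

𝟙-≟-suc : ∀ k m → 𝟙 ⌊ suc k ≟ℕ suc m ⌋ ≡ 𝟙 ⌊ k ≟ℕ m ⌋
𝟙-≟-suc k m with k ≟ℕ m | suc k ≟ℕ suc m
... | yes _   | yes _     = refl
... | no  _   | no  _     = refl
... | yes k≡m | no  k+≢m+ = contradiction (cong suc k≡m) k+≢m+
... | no  k≢m | yes k+≡m+ = contradiction (suc-injective k+≡m+) k≢m

module _ (_≟_ : DecidableEquality A) where

  open import Data.List.Membership.DecPropositional _≟_ using (_∈?_)

  occ : A → List A → ℕ
  occ x = ∑ (λ y → 𝟙 ⌊ y ≟ x ⌋)

  𝟙-≟-sym : ∀ x y → 𝟙 ⌊ x ≟ y ⌋ ≡ 𝟙 ⌊ y ≟ x ⌋
  𝟙-≟-sym x y with x ≟ y | y ≟ x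
  ... | yes _   | yes _   = refl
  ... | no  _   | no  _   = refl
  ... | yes x≡y | no  y≢x = contradiction (sym x≡y) y≢x
  ... | no  x≢y | yes y≡x = contradiction (sym y≡x) x≢y

  occ-∉ : ∀ {x xs} → x ∉ xs → occ x xs ≡ 0
  occ-∉ {x} {[]}     x∉xs = refl
  occ-∉ {x} {y ∷ xs} x∉y∷xs with y ≟ x
  ... | yes y≡x = contradiction (here (sym y≡x)) x∉y∷xs
  ... | no  _   = occ-∉ (λ x∈xs → x∉y∷xs (there x∈xs))

  ∈⇒occ≥1 : ∀ {x xs} → x ∈ xs → 1 ≤ occ x xs
  ∈⇒occ≥1 {x} {y ∷ xs} (here refl) with y ≟ y
  ... | yes _  = s≤s z≤n
  ... | no y≢y = contradiction refl y≢y
  ∈⇒occ≥1 {x} {y ∷ xs} (there x∈xs) = ≤-trans (∈⇒occ≥1 x∈xs) (m≤n+m _ _)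

  occ≥1⇒∈ : ∀ {x xs} → 1 ≤ occ x xs → x ∈ xs
  occ≥1⇒∈ {x} {y ∷ xs} occ≥1 with y ≟ x
  ... | yes refl = here refl
  ... | no  _    = there (occ≥1⇒∈ occ≥1)

  unique⇒occ≤1 : ∀ {x xs} → Unique xs → occ x xs ≤ 1
  unique⇒occ≤1 {x} {[]}     []              = z≤n
  unique⇒occ≤1 {x} {y ∷ xs} (y∉xs ∷ !xs) with y ≟ x
  ... | yes refl = ≤-reflexive (cong suc (occ-∉ (All¬⇒¬Any y∉xs)))
  ... | no  _    = unique⇒occ≤1 !xs

  unique⇒occ≡1 : ∀ {x xs} → Unique xs → x ∈ xs → occ x xs ≡ 1
  unique⇒occ≡1 !xs x∈xs = ≤-antisym (unique⇒occ≤1 !xs) (∈⇒occ≥1 x∈xs)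

  ∑-occ-comm : ∀ xs ys → ∑ (λ x → occ x ys) xs ≡ ∑ (λ y → occ y xs) ys
  ∑-occ-comm xs ys = trans (∑-comm (λ x y → 𝟙 ⌊ y ≟ x ⌋) xs ys)
                           (∑-cong (λ y → ∑-cong (λ x → 𝟙-≟-sym y x) xs) ys)

  -- Double counting: Σ_y ([p′ y] + occ y as) ≤ Σ_y ([p y] + occ y bs), and
  -- the multiplicity sums equal |as| and are at most |bs|.
  count-exchange : ∀ (p p′ : A → Bool) xs as bs → Unique as → length bs ≤ length as →
    (∀ a → a ∈ as → occ a xs ≡ 1 × p a ≡ true) →
    (∀ b → b ∈ bs → occ b xs ≤ 1) →
    (∀ y → y ∈ xs → p′ y ≡ true → y ∈ bs ⊎ (y ∉ as × p y ≡ true)) →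
    count p′ xs ≤ count p xs
  count-exchange p p′ xs as bs !as |bs|≤|as| removed once added =
    +-cancelʳ-≤ (length as) (count p′ xs) (count p xs) (begin
      count p′ xs + length as
        ≡⟨ cong₂ _+_ (count≡∑ p′ xs) (sym (∑-≡-length as (λ a a∈as → proj₁ (removed a a∈as)))) ⟩
      ∑ (λ y → 𝟙 (p′ y)) xs + ∑ (λ a → occ a xs) as
        ≡⟨ cong (∑ (λ y → 𝟙 (p′ y)) xs +_) (∑-occ-comm as xs) ⟩
      ∑ (λ y → 𝟙 (p′ y)) xs + ∑ (λ y → occ y as) xs
        ≡⟨ ∑-+ (λ y → 𝟙 (p′ y)) (λ y → occ y as) xs ⟨
      ∑ (λ y → 𝟙 (p′ y) + occ y as) xs
        ≤⟨ ∑-mono xs pointwise ⟩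
      ∑ (λ y → 𝟙 (p y) + occ y bs) xs
        ≡⟨ ∑-+ (λ y → 𝟙 (p y)) (λ y → occ y bs) xs ⟩
      ∑ (λ y → 𝟙 (p y)) xs + ∑ (λ y → occ y bs) xs
        ≡⟨ cong₂ _+_ (count≡∑ p xs) (∑-occ-comm bs xs) ⟨
      count p xs + ∑ (λ b → occ b xs) bs
        ≤⟨ +-monoʳ-≤ (count p xs) (≤-trans (∑-≤-length bs once) |bs|≤|as|) ⟩
      count p xs + length as ∎)
    where
    open ≤-Reasoning

    occ-as≤ : ∀ y → occ y as ≤ 𝟙 (p y)
    occ-as≤ y with y ∈? as
    ... | yes y∈as rewrite proj₂ (removed y y∈as) = unique⇒occ≤1 !as
    ... | no  y∉as rewrite occ-∉ y∉as = z≤n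

    pointwise : ∀ y → y ∈ xs → 𝟙 (p′ y) + occ y as ≤ 𝟙 (p y) + occ y bs
    pointwise y y∈xs with p′ y in p′y
    ... | false = ≤-trans (occ-as≤ y) (m≤m+n _ _)
    ... | true with added y y∈xs p′y
    ...   | inj₁ y∈bs = subst (_≤ 𝟙 (p y) + occ y bs) (+-comm (occ y as) 1)
                              (+-mono-≤ (occ-as≤ y) (∈⇒occ≥1 y∈bs))
    ...   | inj₂ (y∉as , py) rewrite occ-∉ y∉as | py = s≤s z≤n

-- Paths and the vertex list

module _ {q : ℕ} where

  length-child : ∀ (w : Path q) i → length (child w i) ≡ suc (length w)
  length-child w i = trans (length-++ w) (+-comm (length w) 1)

  child-injectiveˡ : ∀ {w w′ : Path q} {i j} → child w i ≡ child w′ j → w ≡ w′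
  child-injectiveˡ {w} {w′} = ∷ʳ-injectiveˡ w w′

  child-injectiveʳ : ∀ {w : Path q} {i j} → child w i ≡ child w j → i ≡ j
  child-injectiveʳ {w} = ∷ʳ-injectiveʳ w w

  child≢[] : ∀ (w : Path q) i → child w i ≢ []
  child≢[] []      i ()
  child≢[] (_ ∷ _) i ()

  InTree-child : ∀ {d} (w : Path q) i → length w < d → InTree d (child w i)
  InTree-child w i w<d = subst (_≤ _) (sym (length-child w i)) w<d

  InTree-child⁻ : ∀ {d} (w : Path q) i → InTree d (child w i) → length w < d
  InTree-child⁻ w i wi≤d = subst (_≤ _) (length-child w i) wi≤d

  ∷-child : ∀ (a : Fin q) t → ∃[ p ] ∃[ c ] a ∷ t ≡ child p c
  ∷-child a []      = [] , a , refl
  ∷-child a (b ∷ t) with ∷-child b t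
  ... | p , c , b∷t≡pc = a ∷ p , c , cong (a ∷_) b∷t≡pc

  extension≢nephew : ∀ (u t : Path q) {a b i} → a ≢ b → u ++ a ∷ t ≢ child (child u b) i
  extension≢nephew u t {a} {b} {i} a≢b eq =
    a≢b (∷-injectiveˡ (++-cancelˡ u (a ∷ t) (b ∷ [ i ]) (trans eq (++-assoc u [ b ] [ i ]))))

  Lex-++ : ∀ (u : Path q) {a b s s′} → a <ᶠ b → Lex (u ++ a ∷ s) (u ++ b ∷ s′)
  Lex-++ []      a<b = here a<b
  Lex-++ (_ ∷ u) a<b = there (Lex-++ u a<b)

  children : Path q → List (Path q)
  children w = map (child w) (allFin q)

  ∈-children⁻ : ∀ {w y : Path q} → y ∈ children w → ∃[ i ] y ≡ child w i
  ∈-children⁻ {w} y∈ = let i , _ , y≡wi = ∈-map⁻ (child w) y∈ in i , y≡wi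

  occ-children : ∀ (w p : Path q) c → occ _≟ₚ_ (child p c) (children w) ≡ 𝟙 ⌊ w ≟ₚ p ⌋
  occ-children w p c with w ≟ₚ p
  ... | yes refl = unique⇒occ≡1 _≟ₚ_ (map⁺ child-injectiveʳ (allFin⁺ q)) (∈-map⁺ (child w) (∈-allFin c))
  ... | no  w≢p  = occ-∉ _≟ₚ_ {xs = children w}
                     (λ pc∈ → w≢p (sym (child-injectiveˡ (proj₂ (∈-children⁻ pc∈)))))

  occ-[]-levelVs : ∀ k → occ _≟ₚ_ [] (levelVs q (suc k)) ≡ 0
  occ-[]-levelVs k = trans (∑-concatMap _ children (levelVs q k))
    (∑-zero (λ w → occ-∉ _≟ₚ_ {xs = children w} (λ []∈ → child≢[] w _ (sym (proj₂ (∈-children⁻ []∈)))))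
            (levelVs q k))

  occ-levelVs : ∀ (x : Path q) k → occ _≟ₚ_ x (levelVs q k) ≡ 𝟙 ⌊ k ≟ℕ length x ⌋
  occ-levelVs []      zero    = refl
  occ-levelVs (_ ∷ _) zero    = refl
  occ-levelVs []      (suc k) = occ-[]-levelVs k
  occ-levelVs (a ∷ t) (suc k) with ∷-child a t
  ... | p , c , a∷t≡pc =
    subst (λ x → occ _≟ₚ_ x (levelVs q (suc k)) ≡ 𝟙 ⌊ suc k ≟ℕ length x ⌋) (sym a∷t≡pc) (begin
      occ _≟ₚ_ (child p c) (levelVs q (suc k))
        ≡⟨ ∑-concatMap _ children (levelVs q k) ⟩
      ∑ (λ w → occ _≟ₚ_ (child p c) (children w)) (levelVs q k)
        ≡⟨ ∑-cong (λ w → occ-children w p c) (levelVs q k) ⟩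
      occ _≟ₚ_ p (levelVs q k)
        ≡⟨ occ-levelVs p k ⟩
      𝟙 ⌊ k ≟ℕ length p ⌋
        ≡⟨ 𝟙-≟-suc k (length p) ⟨
      𝟙 ⌊ suc k ≟ℕ suc (length p) ⌋
        ≡⟨ cong (λ m → 𝟙 ⌊ suc k ≟ℕ m ⌋) (length-child p c) ⟨
      𝟙 ⌊ suc k ≟ℕ length (child p c) ⌋ ∎)
    where open ≡-Reasoning

  occ-vertices : ∀ d (x : Path q) → occ _≟ₚ_ x (vertices q d) ≡ occ _≟ℕ_ (length x) (upTo (suc d))
  occ-vertices d x = trans (∑-concatMap _ (levelVs q) (upTo (suc d)))
                           (∑-cong (occ-levelVs x) (upTo (suc d)))

  occ-vertices≡1 : ∀ {d} {x : Path q} → InTree d x → occ _≟ₚ_ x (vertices q d) ≡ 1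
  occ-vertices≡1 {d} {x} x≤d =
    trans (occ-vertices d x) (unique⇒occ≡1 _≟ℕ_ (upTo⁺ (suc d)) (∈-upTo⁺ (s≤s x≤d)))

  occ-vertices≤1 : ∀ d (x : Path q) → occ _≟ₚ_ x (vertices q d) ≤ 1
  occ-vertices≤1 d x =
    subst (_≤ 1) (sym (occ-vertices d x)) (unique⇒occ≤1 _≟ℕ_ {xs = upTo (suc d)} (upTo⁺ (suc d)))

  ∈-vertices⁺ : ∀ {d} {x : Path q} → InTree d x → x ∈ vertices q d
  ∈-vertices⁺ x≤d = occ≥1⇒∈ _≟ₚ_ (≤-reflexive (sym (occ-vertices≡1 x≤d)))

  ∈-vertices⁻ : ∀ {d} {x : Path q} → x ∈ vertices q d → InTree d x
  ∈-vertices⁻ {d} {x} x∈V = ≤-pred (∈-upTo⁻ (occ≥1⇒∈ _≟ℕ_ {xs = upTo (suc d)}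
    (subst (1 ≤_) (occ-vertices d x) (∈⇒occ≥1 _≟ₚ_ x∈V))))

  child-listed : ∀ (w : Path q) i → any (λ j → ⌊ child w i ≟ₚ child w j ⌋) (allFin q) ≡ true
  child-listed w i = any≡true⁺ _ (∈-allFin i) (isYes⁺ (child w i ≟ₚ child w i) refl)

  adj-parent : ∀ (w : Path q) i → adj (child w i) w ≡ true
  adj-parent w i rewrite child-listed w i = ∨-zeroʳ _

  adj⇒child⊎parent : ∀ (x y : Path q) → adj x y ≡ true → (∃[ i ] y ≡ child x i) ⊎ (∃[ i ] x ≡ child y i)
  adj⇒child⊎parent x y adj≡true with any (λ i → ⌊ y ≟ₚ child x i ⌋) (allFin q) in down
  ... | true  with any≡true⁻ _ (allFin q) down
  ...   | i , _ , y≡xi = inj₁ (i , isYes⁻ (y ≟ₚ child x i) y≡xi)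
  adj⇒child⊎parent x y adj≡true | false with any≡true⁻ _ (allFin q) adj≡true
  ...   | i , _ , x≡yi = inj₂ (i , isYes⁻ (x ≟ₚ child y i) x≡yi)

  adj-child⁻ : ∀ {u z : Path q} {e} → adj (child u e) z ≡ true → z ≡ u ⊎ ∃[ i ] z ≡ child (child u e) i
  adj-child⁻ {u = u} {z} {e} ue~z with adj⇒child⊎parent (child u e) z ue~z
  ... | inj₁ (i , z≡uei) = inj₂ (i , z≡uei)
  ... | inj₂ (i , ue≡zi) = inj₁ (sym (child-injectiveˡ ue≡zi))

-- Boundaries and swaps

-- Opaque, so that lemmas about onBoundary d T y can infer T and y.
opaque
  onBoundary : ∀ {q} → ℕ → VSet q → Path q → Bool
  onBoundary {q} d T x = not (T x) ∧ any (λ y → adj x y ∧ T y) (vertices q d)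

opaque
  unfolding onBoundary

  onBoundary⁺ : ∀ {q d} {T : VSet q} {y z} → T y ≡ false → InTree d z → adj y z ≡ true →
                T z ≡ true → onBoundary d T y ≡ true
  onBoundary⁺ {q} {d} {T} {y} y∉T z≤d y~z z∈T =
    subst (λ b → not b ∧ any (λ w → adj y w ∧ T w) (vertices q d) ≡ true) (sym y∉T)
      (any≡true⁺ (λ w → adj y w ∧ T w) (∈-vertices⁺ z≤d) (cong₂ _∧_ y~z z∈T))

  onBoundary⁻ : ∀ {q d} {T : VSet q} {y} → onBoundary d T y ≡ true →
                T y ≡ false × ∃[ z ] InTree d z × adj y z ≡ true × T z ≡ true
  onBoundary⁻ {q} {d} {T} {y} y∈∂ with T y
  ... | false with any≡true⁻ _ (vertices q d) y∈∂
  ...   | z , z∈V , y~z∧z∈T = refl , z , ∈-vertices⁻ z∈V , ∧≡true⁻ y~z∧z∈T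

  boundary-exchange : ∀ {q d} (T T′ : VSet q) as bs → Unique as → length bs ≤ length as →
    (∀ a → a ∈ as → InTree d a × onBoundary d T a ≡ true) →
    (∀ y → InTree d y → onBoundary d T′ y ≡ true → y ∈ bs ⊎ (y ∉ as × onBoundary d T y ≡ true)) →
    boundarySize q d T′ ≤ boundarySize q d T
  boundary-exchange {q} {d} T T′ as bs !as |bs|≤|as| removed added =
    count-exchange _≟ₚ_ (onBoundary d T) (onBoundary d T′) (vertices q d) as bs !as |bs|≤|as|
      (λ a a∈as → occ-vertices≡1 (proj₁ (removed a a∈as)) , proj₂ (removed a a∈as))
      (λ b _ → occ-vertices≤1 d b)
      (λ y y∈V → added y (∈-vertices⁻ y∈V))

module _ {q : ℕ} (S : VSet q) (u x : Path q) where

  swapSet-new : swapSet S u x x ≡ true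
  swapSet-new rewrite isYes⁺ (x ≟ₚ x) refl = refl

  swapSet-old : ∀ {w} → w ≢ x → w ≢ u → swapSet S u x w ≡ S w
  swapSet-old {w} w≢x w≢u with w ≟ₚ x | w ≟ₚ u
  ... | yes w≡x | _       = contradiction w≡x w≢x
  ... | no  _   | yes w≡u = contradiction w≡u w≢u
  ... | no  _   | no  _   = ∧-identityʳ (S w)

  swapSet⁻ : ∀ {w} → swapSet S u x w ≡ true → w ≡ x ⊎ (S w ≡ true × w ≢ u)
  swapSet⁻ {w} w∈S′ with w ≟ₚ x | w ≟ₚ u
  ... | yes w≡x | _       = inj₁ w≡x
  ... | no  _   | yes _   = contradiction (trans (sym (∧-zeroʳ (S w))) w∈S′) λ ()
  ... | no  _   | no  w≢u = inj₂ (trans (sym (∧-identityʳ (S w))) w∈S′ , w≢u)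

out≢in : ∀ {q} (S : VSet q) {a b} → S a ≡ false → S b ≡ true → a ≢ b
out≢in S a∉S b∈S refl with () ← trans (sym a∉S) b∈S

module _ {q d : ℕ} {S : VSet q} {u x : Path q} where

  swap-boundary-≢new : ∀ {y} → onBoundary d (swapSet S u x) y ≡ true → y ≢ x
  swap-boundary-≢new y∈∂ refl with () ← trans (sym (proj₁ (onBoundary⁻ y∈∂))) (swapSet-new S u x)

  swap-boundary⁻ : ∀ {y} → onBoundary d (swapSet S u x) y ≡ true → y ≢ u →
    S y ≡ false × ∃[ z ] InTree d z × adj y z ≡ true × (z ≡ x ⊎ (S z ≡ true × z ≢ u))
  swap-boundary⁻ y∈∂ y≢u with onBoundary⁻ y∈∂
  ... | y∉S′ , z , z≤d , y~z , z∈S′ =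
    trans (sym (swapSet-old S u x (swap-boundary-≢new y∈∂) y≢u)) y∉S′ , z , z≤d , y~z , swapSet⁻ S u x z∈S′

  -- Only the parent p of x can enter the boundary through x, since x's children stay in S.
  swap-boundary-saturated : ∀ {p c y} → ¬ HasChildOut d S x → x ≡ child p c → InTree d y →
    onBoundary d (swapSet S u x) y ≡ true → y ≢ u → y ≢ p → onBoundary d S y ≡ true
  swap-boundary-saturated {p} {c} {y} x-sat x≡pc y≤d y∈∂ y≢u y≢p with swap-boundary⁻ y∈∂ y≢u
  ... | y∉S , z , z≤d , y~z , inj₂ (z∈S , _) = onBoundary⁺ y∉S z≤d y~z z∈S
  ... | y∉S , z , z≤d , y~z , inj₁ refl with adj⇒child⊎parent y x y~z
  ...   | inj₁ (_ , x≡yi) = contradiction (child-injectiveˡ (trans (sym x≡yi) x≡pc)) y≢p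
  ...   | inj₂ (i , refl) = contradiction (InTree-child⁻ x i y≤d , i , y∉S) x-sat

  swap-boundary-childless : ∀ {e} → S x ≡ false → S u ≡ true → S (child u e) ≡ false →
    ¬ HasChildIn d S (child u e) → onBoundary d (swapSet S u x) (child u e) ≡ true →
    ∃[ i ] x ≡ child (child u e) i
  swap-boundary-childless x∉S u∈S ue∉S ue-childless ue∈∂ with swap-boundary⁻ ue∈∂ (out≢in S ue∉S u∈S)
  ... | _ , z , z≤d , ue~z , inj₁ refl with adj-child⁻ ue~z
  ...   | inj₁ x≡u  = contradiction x≡u (out≢in S x∉S u∈S)
  ...   | inj₂ x≡ue = x≡ue
  swap-boundary-childless _ _ _ ue-childless _
      | _ , z , z≤d , ue~z , inj₂ (z∈S , z≢u) with adj-child⁻ ue~z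
  ...   | inj₁ z≡u = contradiction z≡u z≢u
  ...   | inj₂ (i , refl) = contradiction (InTree-child⁻ (child u _) i z≤d , i , z∈S) ue-childless

-- Compressed sets

module _ {q d : ℕ} {S : VSet q} where

  hasChildIn? : ∀ w → Dec (HasChildIn d S w)
  hasChildIn? w = (length w <? d) ×-dec any? (λ i → S (child w i) ≟ᵇ true)

  hasChildOut? : ∀ w → Dec (HasChildOut d S w)
  hasChildOut? w = (length w <? d) ×-dec any? (λ i → S (child w i) ≟ᵇ false)

  down-swap-impossible : ∀ {u x} → DownCompressed q d S → InTree d u → InTree d x →
    S u ≡ true → S x ≡ false → length u < length x →
    boundarySize q d (swapSet S u x) ≤ boundarySize q d S → ⊥
  down-swap-impossible {u} {x} dc u≤d x≤d u∈S x∉S u<x ∂′≤∂ =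
    dc u x u≤d x≤d (u∈S , x∉S , map₂ (_, u<x) (m≤n⇒m<n∨m≡n ∂′≤∂))

  out-child-has-out-child : ∀ {u j} → DownCompressed q d S → InTree d u → S u ≡ true → length u < d →
    S (child u j) ≡ false → HasChildOut d S (child u j)
  out-child-has-out-child {u} {j} dc u≤d u∈S u<d v∉S with hasChildOut? (child u j)
  ... | yes v-out = v-out
  ... | no  v-sat = ⊥-elim (down-swap-impossible dc u≤d v≤d u∈S v∉S (≤-reflexive (sym (length-child u j)))
                      (boundary-exchange S (swapSet S u v) [ v ] [ u ] ([] ∷ []) ≤-refl removed added))
    where
    v = child u j
    v≤d : InTree d v
    v≤d = InTree-child u j u<d
    removed : ∀ a → a ∈ [ v ] → InTree d a × onBoundary d S a ≡ true
    removed _ (here refl) = v≤d , onBoundary⁺ v∉S u≤d (adj-parent u j) u∈S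
    added : ∀ y → InTree d y → onBoundary d (swapSet S u v) y ≡ true →
            y ∈ [ u ] ⊎ (y ∉ [ v ] × onBoundary d S y ≡ true)
    added y y≤d y∈∂ with y ≟ₚ u
    ... | yes y≡u = inj₁ (here y≡u)
    ... | no  y≢u = inj₂ ((λ { (here y≡v) → swap-boundary-≢new y∈∂ y≡v })
                         , swap-boundary-saturated v-sat refl y≤d y∈∂ y≢u y≢u)

  OutWithChildrenIn : Path q → Set
  OutWithChildrenIn x = S x ≡ false × InTree d x × ¬ HasChildOut d S x

  saturated-descendant : ∀ {w} → S w ≡ false → InTree d w → ∃[ t ] OutWithChildrenIn (w ++ t)
  saturated-descendant {w} = descend d w (m≤m+n d (length w))
    where
    -- The fuel n bounds the remaining depth d − |w|.
    descend : ∀ n (w : Path q) → d ≤ n + length w → S w ≡ false → InTree d w →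
              ∃[ t ] OutWithChildrenIn (w ++ t)
    descend n w _ w∉S w≤d with hasChildOut? w
    ... | no w-sat = [] , subst OutWithChildrenIn (sym (++-identityʳ w)) (w∉S , w≤d , w-sat)
    descend zero    w d≤w _ _ | yes (w<d , _) = contradiction d≤w (<⇒≱ w<d)
    descend (suc n) w d≤ _ _  | yes (w<d , i , wi∉S)
      with descend n (child w i) d≤′ wi∉S (InTree-child w i w<d)
      where
      d≤′ : d ≤ n + length (child w i)
      d≤′ = subst (d ≤_) (trans (sym (+-suc n (length w))) (cong (n +_) (sym (length-child w i)))) d≤
    ... | t , x-sat = i ∷ t , subst OutWithChildrenIn (++-assoc w [ i ] t) x-sat

  two-childless-out-children-impossible : ∀ {u a b} → DownCompressed q d S → InTree d u → S u ≡ true →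
    length u < d → a ≢ b → S (child u a) ≡ false → S (child u b) ≡ false →
    ¬ HasChildIn d S (child u a) → ¬ HasChildIn d S (child u b) → ⊥
  two-childless-out-children-impossible {u} {a} {b} dc u≤d u∈S u<d a≢b v₁∉S v₂∉S v₁-childless v₂-childless
    with saturated-descendant v₁∉S (InTree-child u a u<d)
  ... | t , x∉S , x≤d , x-sat with ∷-child a t
  ...   | p′ , c , a∷t≡p′c =
    down-swap-impossible dc u≤d x≤d u∈S x∉S u<x
      (boundary-exchange S S′ (v₁ ∷ v₂ ∷ []) (u ∷ p ∷ []) ((v₁≢v₂ ∷ []) ∷ [] ∷ []) ≤-refl removed added)
    where
    v₁ = child u a
    v₂ = child u b
    x = v₁ ++ t
    p = u ++ p′
    S′ = swapSet S u x
    v₁≢v₂ : v₁ ≢ v₂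
    v₁≢v₂ v₁≡v₂ = a≢b (child-injectiveʳ v₁≡v₂)
    x≡u++a∷t : x ≡ u ++ a ∷ t
    x≡u++a∷t = ++-assoc u [ a ] t
    x≡pc : x ≡ child p c
    x≡pc = trans x≡u++a∷t (trans (cong (u ++_) a∷t≡p′c) (sym (++-assoc u p′ [ c ])))
    u<x : length u < length x
    u<x = ≤-trans (≤-reflexive (sym (length-child u a))) (length-++-≤ˡ v₁)
    removed : ∀ w → w ∈ v₁ ∷ v₂ ∷ [] → InTree d w × onBoundary d S w ≡ true
    removed _ (here refl)         = InTree-child u a u<d , onBoundary⁺ v₁∉S u≤d (adj-parent u a) u∈S
    removed _ (there (here refl)) = InTree-child u b u<d , onBoundary⁺ v₂∉S u≤d (adj-parent u b) u∈S
    added : ∀ y → InTree d y → onBoundary d S′ y ≡ true →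
            y ∈ u ∷ p ∷ [] ⊎ (y ∉ v₁ ∷ v₂ ∷ [] × onBoundary d S y ≡ true)
    added y y≤d y∈∂′ with y ≟ₚ u | y ≟ₚ p
    ... | yes y≡u | _       = inj₁ (here y≡u)
    ... | no  _   | yes y≡p = inj₁ (there (here y≡p))
    ... | no  y≢u | no  y≢p = inj₂ (y∉vs , swap-boundary-saturated x-sat x≡pc y≤d y∈∂′ y≢u y≢p)
      where
      y∉vs : y ∉ v₁ ∷ v₂ ∷ []
      y∉vs (here refl) with swap-boundary-childless x∉S u∈S v₁∉S v₁-childless y∈∂′
      ... | _ , x≡v₁i = y≢p (child-injectiveˡ (trans (sym x≡v₁i) x≡pc))
      y∉vs (there (here refl)) with swap-boundary-childless x∉S u∈S v₂∉S v₂-childless y∈∂′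
      ... | _ , x≡v₂i = extension≢nephew u t a≢b (trans (sym x≡u++a∷t) x≡v₂i)

  out-grandchild-left-of-in-grandchild : ∀ {u a b} → LeftCompressed q d S → a <ᶠ b →
    HasChildOut d S (child u a) → HasChildIn d S (child u b) → ⊥
  out-grandchild-left-of-in-grandchild {u} {a} {b} lc a<b (ua<d , i , x∉S) (ub<d , j , y∈S) =
    lc x y (InTree-child (child u a) i ua<d) (InTree-child (child u b) j ub<d)
      ((same-level , x-before-y) , inj₁ (x∉S , y∈S))
    where
    x = child (child u a) i
    y = child (child u b) j
    same-level : length x ≡ length y
    same-level = begin
      length x                   ≡⟨ length-child (child u a) i ⟩
      suc (length (child u a))   ≡⟨ cong suc (length-child u a) ⟩
      suc (suc (length u))       ≡⟨ cong suc (length-child u b) ⟨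
      suc (length (child u b))   ≡⟨ length-child (child u b) j ⟨
      length y                   ∎
      where open ≡-Reasoning
    x-before-y : Lex x y
    x-before-y = subst₂ Lex (sym (++-assoc u [ a ] [ i ])) (sym (++-assoc u [ b ] [ j ])) (Lex-++ u a<b)

  no-two-mixed-children : ∀ {u j k} → LeftCompressed q d S → j ≢ k →
    HasChildIn d S (child u j) → HasChildOut d S (child u j) →
    HasChildIn d S (child u k) → HasChildOut d S (child u k) → ⊥
  no-two-mixed-children {j = j} {k} lc j≢k j-in j-out k-in k-out with <ᶠ-cmp j k
  ... | tri< j<k _ _ = out-grandchild-left-of-in-grandchild lc j<k j-out k-in
  ... | tri≈ _ j≡k _ = j≢k j≡k
  ... | tri> _ _ k<j = out-grandchild-left-of-in-grandchild lc k<j k-out j-in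

  out-siblings-opposite : ∀ {u j k} → LeftCompressed q d S → DownCompressed q d S →
    InTree d u → S u ≡ true → length u < d → j ≢ k →
    S (child u j) ≡ false → S (child u k) ≡ false →
    Opposite (HasChildIn d S (child u j)) (HasChildIn d S (child u k))
  out-siblings-opposite {u} {j} {k} lc dc u≤d u∈S u<d j≢k j∉S k∉S
    with hasChildIn? (child u j) | hasChildIn? (child u k)
  ... | yes j-in    | yes k-in    = ⊥-elim (no-two-mixed-children lc j≢k
                                      j-in (out-child-has-out-child dc u≤d u∈S u<d j∉S)
                                      k-in (out-child-has-out-child dc u≤d u∈S u<d k∉S))
  ... | yes j-in    | no  k-empty = inj₁ (j-in , k-empty)
  ... | no  j-empty | yes k-in    = inj₂ (j-empty , k-in)
  ... | no  j-empty | no  k-empty =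
    ⊥-elim (two-childless-out-children-impossible dc u≤d u∈S u<d j≢k j∉S k∉S j-empty k-empty)

  at-most-two-out-children : ∀ {u j k l} → LeftCompressed q d S → DownCompressed q d S →
    InTree d u → S u ≡ true → length u < d → j ≢ k → j ≢ l → k ≢ l →
    S (child u j) ≡ false → S (child u k) ≡ false → S (child u l) ≡ false → ⊥
  at-most-two-out-children {u} lc dc u≤d u∈S u<d j≢k j≢l k≢l j∉S k∉S l∉S =
    opposite-triangle (opposite j≢k j∉S k∉S) (opposite j≢l j∉S l∉S) (opposite k≢l k∉S l∉S)
    where
    opposite : ∀ {j k} → j ≢ k → S (child u j) ≡ false → S (child u k) ≡ false →
               Opposite (HasChildIn d S (child u j)) (HasChildIn d S (child u k))
    opposite = out-siblings-opposite lc dc u≤d u∈S u<d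

lemma2p4 : (q d : ℕ) → 2 ≤ q → (S : VSet q) →
    LeftCompressed q d S → DownCompressed q d S →
    (u : Path q) → InTree d u → S u ≡ true →
    (length u < d → ∀ (i : Fin q) → S (child u i) ≡ true)
    ⊎ (length u < d × ∃[ j ]
        (S (child u j) ≡ false
         × (∀ (i : Fin q) → i ≢ j → S (child u i) ≡ true)
         × HasChildOut d S (child u j)))
    ⊎ (length u < d × ∃[ j ] ∃[ k ]
        (j ≢ k × S (child u j) ≡ false × S (child u k) ≡ false
         × (∀ (i : Fin q) → i ≢ j → i ≢ k → S (child u i) ≡ true)
         × HasChildIn d S (child u j) × HasChildOut d S (child u j)
         × ¬ HasChildIn d S (child u k)))
lemma2p4 q d _ S lc dc u u≤d u∈S with length u <? d
... | no  u≮d = inj₁ (λ u<d → contradiction u<d u≮d)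
... | yes u<d with none⊎one⊎two⊎three (λ i → S (child u i) ≟ᵇ false)
... | inj₁ none = inj₁ (λ _ i → ¬-not (none i))
... | inj₂ (inj₁ (j , j∉S , others)) =
  inj₂ (inj₁ (u<d , j , j∉S , (λ i i≢j → ¬-not (others i i≢j)) ,
               out-child-has-out-child dc u≤d u∈S u<d j∉S))
... | inj₂ (inj₂ (inj₁ (j , k , j≢k , j∉S , k∉S , others)))
  with out-siblings-opposite lc dc u≤d u∈S u<d j≢k j∉S k∉S
...   | inj₁ (j-in , k-empty) =
  inj₂ (inj₂ (u<d , j , k , j≢k , j∉S , k∉S , (λ i i≢j i≢k → ¬-not (others i i≢j i≢k)) ,
               j-in , out-child-has-out-child dc u≤d u∈S u<d j∉S , k-empty))
...   | inj₂ (j-empty , k-in) =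
  inj₂ (inj₂ (u<d , k , j , ≢-sym j≢k , k∉S , j∉S , (λ i i≢k i≢j → ¬-not (others i i≢j i≢k)) ,
               k-in , out-child-has-out-child dc u≤d u∈S u<d k∉S , j-empty))
lemma2p4 q d _ S lc dc u u≤d u∈S | yes u<d
  | inj₂ (inj₂ (inj₂ (j , k , l , j≢k , j≢l , k≢l , j∉S , k∉S , l∉S))) =
  ⊥-elim (at-most-two-out-children lc dc u≤d u∈S u<d j≢k j≢l k≢l j∉S k∉S l∉S)
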